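{- Let $R=\mathrm{GR}(4,m)$ with residue field $K$ and reduction map $\mu:R\to K$ (applied coefficientwise to polynomials). Let $t\ge1$, let $T\in R[[z]]$, and let $M=\{[a,b]\in R[z]^2 : a(1+T)\equiv b \bmod z^{t+1}\}$. Let $[a,b]\in M$ with $\deg a\le\frac{t+1}{2}$, $\deg b\le\frac t2$, and $2\in R[z]a+R[z]b$. Suppose further that the leading coefficient of $a$ is a unit of $R$ if $\deg a>\deg b$, and the leading coefficient of $b$ is a unit of $R$ if $\deg a\le\deg b$. Then: (a) $[a,b]$ is minimal in $M\setminus(M\cap 2R[z]^2)$ with respect to $<_{ -1}$; moreover, if $[a',b']$ is minimal in $M\setminus(M\cap2R[z]^2)$ then $[\mu a,\mu b]=\nu[\mu a',\mu b']$ for some $\nu\in K^\times$. (b) If in addition $R[z]a+R[z]b=R[z]$, then $[a,b]$ is minimal in $M\setminus\{0\}$ with respect to $<_{ -1}$, and if $[a',b']$ is minimal in $M\setminus(M\cap2R[z]^2)$ then $[a,b]=\theta[a',b']$ for some $\theta\in R^\times$.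
   Context: The terms of $R[z]^2$ are $[z^i,0]$ and $[0,z^j]$ ($i,j\ge0$). The term order $<_{ -1}$ is: $[z^i,0]<_{ -1}[z^j,0]$ and $[0,z^i]<_{ -1}[0,z^j]$ iff $i<j$; and $[0,z^j]<_{ -1}[z^i,0]$ iff $j\le i-1$ (otherwise $[z^i,0]<_{ -1}[0,z^j]$). Every nonzero $[a,b]\in R[z]^2$ is uniquely a sum of terms with nonzero coefficients in $R$; its leading term $\mathrm{lt}[a,b]$ is the largest term occurring, with respect to $<_{ -1}$, and its leading coefficient is the coefficient of that term. An element $x$ of a set $A\subseteq R[z]^2\setminus\{0\}$ is minimal in $A$ with respect to $<_{ -1}$ if $\mathrm{lt}(x)\le_{ -1}\mathrm{lt}(y)$ for all $y\in A$. $\deg$ denotes polynomial degree. -}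

module Defs where

open import Level using (Level; _⊔_)
open import Algebra.Bundles using (CommutativeRing)
open import Data.Nat using (ℕ; zero; suc; _∸_; _^_; _<_; _≤_)
open import Data.Fin using (Fin)
open import Data.Product using (Σ; ∃; _×_; _,_)
open import Data.Sum using (_⊎_)
open import Relation.Nullary using (¬_)
open import Relation.Binary.PropositionalEquality using (_≡_)

module Ring {c ℓ : Level} (R : CommutativeRing c ℓ) where
  open CommutativeRing R hiding (Carrier; _≈_; 0#; 1#)
  open CommutativeRing R public using (Carrier; _≈_; 0#; 1#) renaming (_*_ to _*R_)

  two : Carrier
  two = 1# + 1#

  IsUnit : Carrier → Set (c ⊔ ℓ)
  IsUnit x = ∃ λ y → x * y ≈ 1#

  In2R : Carrier → Set (c ⊔ ℓ)
  In2R x = ∃ λ y → x ≈ two * y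

  -- R ≅ GR(4,m): a finite commutative local ring of characteristic 4
  -- with 4^m elements whose maximal ideal is 2R (this characterises
  -- the Galois ring GR(4,m) up to isomorphism).
  record IsGR4 (m : ℕ) : Set (c ⊔ ℓ) where
    field
      enum       : Fin (4 ^ m) → Carrier
      enum-onto  : ∀ x → ∃ λ i → x ≈ enum i
      enum-inj   : ∀ i j → enum i ≈ enum j → i ≡ j
      char4      : two + two ≈ 0#
      two≉0      : ¬ (two ≈ 0#)
      local2     : ∀ x → IsUnit x ⊎ In2R x

  -- Residue field K = R/2R, presented as the setoid on Carrier with
  -- equality "difference lies in 2R"; the reduction map μ : R → K is
  -- the identity on carriers (applied coefficientwise to polynomials).
  _≈K_ : Carrier → Carrier → Set (c ⊔ ℓ)
  x ≈K y = In2R (x - y)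

  IsKUnit : Carrier → Set (c ⊔ ℓ)
  IsKUnit ν = ∃ λ w → (ν * w) ≈K 1#

  Series : Set c
  Series = ℕ → Carrier

  record Poly : Set (c ⊔ ℓ) where
    field
      coeff  : ℕ → Carrier
      bound  : ℕ
      vanish : ∀ i → bound ≤ i → coeff i ≈ 0#
  open Poly public

  sumTo : ℕ → (ℕ → Carrier) → Carrier
  sumTo zero    h = h 0
  sumTo (suc n) h = sumTo n h + h (suc n)

  conv : Series → Series → Series
  conv f g i = sumTo i (λ j → f j * g (i ∸ j))

  const : Carrier → Series
  const r zero    = r
  const r (suc i) = 0#

  onePlus : Series → Series
  onePlus T zero    = 1# + T 0
  onePlus T (suc i) = T (suc i)

  -- Terms of R[z]^2 : [z^i,0] = fstT i , [0,z^j] = sndT j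
  data Term : Set where
    fstT : ℕ → Term
    sndT : ℕ → Term

  data _<T_ : Term → Term → Set where
    ff : ∀ {i j} → i < j → fstT i <T fstT j
    ss : ∀ {i j} → i < j → sndT i <T sndT j
    sf : ∀ {i j} → suc j ≤ i → sndT j <T fstT i
    fs : ∀ {i j} → ¬ (suc j ≤ i) → fstT i <T sndT j

  _≤T_ : Term → Term → Set
  τ ≤T σ = τ <T σ ⊎ τ ≡ σ

  coeffT : Poly → Poly → Term → Carrier
  coeffT a b (fstT i) = coeff a i
  coeffT a b (sndT j) = coeff b j

  IsLT : Poly → Poly → Term → Set ℓ
  IsLT a b τ = ¬ (coeffT a b τ ≈ 0#) × (∀ σ → τ <T σ → coeffT a b σ ≈ 0#)

  Minimal : ∀ {ℓ'} → (Poly → Poly → Set ℓ') → Poly → Poly → Set (c ⊔ ℓ ⊔ ℓ')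
  Minimal A a b = A a b ×
    (∀ a' b' → A a' b' → ∀ τ σ → IsLT a b τ → IsLT a' b' σ → τ ≤T σ)

  InM : ℕ → Series → Poly → Poly → Set ℓ
  InM t T a b = ∀ i → i ≤ t → conv (coeff a) (onePlus T) i ≈ coeff b i

  In2Poly : Poly → Poly → Set (c ⊔ ℓ)
  In2Poly a b = ∃ λ (a₀ : Poly) → ∃ λ (b₀ : Poly) →
    (∀ i → coeff a i ≈ two * coeff a₀ i) × (∀ i → coeff b i ≈ two * coeff b₀ i)

  NonZero2 : Poly → Poly → Set ℓ
  NonZero2 a b = ¬ (∀ i → (coeff a i ≈ 0#) × (coeff b i ≈ 0#))

  M∖2M : ℕ → Series → Poly → Poly → Set (c ⊔ ℓ)
  M∖2M t T a b = InM t T a b × ¬ In2Poly a b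

  M∖0 : ℕ → Series → Poly → Poly → Set ℓ
  M∖0 t T a b = InM t T a b × NonZero2 a b

  InIdeal : Carrier → Poly → Poly → Set (c ⊔ ℓ)
  InIdeal r a b = ∃ λ (u : Poly) → ∃ λ (v : Poly) →
    ∀ i → conv (coeff u) (coeff a) i + conv (coeff v) (coeff b) i ≈ const r i

  IsDeg : Poly → ℕ → Set ℓ
  IsDeg p n = ¬ (coeff p n ≈ 0#) × (∀ i → n < i → coeff p i ≈ 0#)

module Submission where

-- (1) Cross-multiplication: if [c,d] ∈ M has no terms above τ then a·d = b·c; coefficients of
--     index ≤ t agree because both pairs lie in M, higher ones vanish by the degree bounds.
-- (2) Hence, if u·a + v·b = r, then r·[c,d] = w·[a,b] with w = u·c + v·d.
-- (3) Division by the leading term: if [c,d] ≡ w·[a,b] modulo an ideal I and j is the top index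
--     with w_j ∉ I, then the coefficient of [c,d] at z^j·τ is ∉ I, because lc(τ) is a unit.
-- For r = 2, (3) with I = 2R shows that w ∈ 2R[z], so [c,d] ≡ w'·[a,b] mod 2 where w = 2w'.
-- Applying (3) again, a pair [c,d] ∉ 2R[z]² whose leading term is below τ cannot exist, which is
-- minimality; if [c,d] is minimal, the top index must be j = 0, so w' is a unit constant mod 2,
-- which is uniqueness up to K^×.  For r = 1 the same argument with I = 0 gives part (b).

open import Defs
open import Level using (Level; _⊔_)
open import Algebra.Bundles using (CommutativeRing)
open import Data.Nat using (ℕ; suc)
open import Data.Product using (∃; _×_)

open import Data.Nat as N using (zero; _∸_; z≤n; s≤s)
import Data.Nat.Properties as NP
open import Data.Product using (Σ; _,_; proj₁; proj₂)
open import Data.Sum using (_⊎_; inj₁; inj₂)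
open import Data.Empty using (⊥-elim)
import Data.Fin.Properties as FP
open import Relation.Nullary using (¬_; Dec; yes; no)
open import Relation.Binary.PropositionalEquality as PE using (_≡_; _≢_)
open import Relation.Binary.Definitions using (tri<; tri≈; tri>)

module Proof {ℓ₁ ℓ₂ : Level} (R : CommutativeRing ℓ₁ ℓ₂) where
  open CommutativeRing R hiding (Carrier; _≈_; 0#; 1#)
  open Defs.Ring R
  open import Relation.Binary.Reasoning.Setoid setoid
  open import Algebra.Solver.CommutativeMonoid +-commutativeMonoid using (solve; _⊜_; _⊕_)
  open import Algebra.Properties.Ring ring
    using (-1*x≈-x; x∙y⁻¹≈ε⇒x≈y; x≈y⇒x∙y⁻¹≈ε; ⁻¹-anti-homo‿-; x[y-z]≈xy-xz)

  sum-cong : ∀ n (h h' : ℕ → Carrier) → (∀ j → j N.≤ n → h j ≈ h' j) → sumTo n h ≈ sumTo n h'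
  sum-cong zero    h h' e = e 0 z≤n
  sum-cong (suc n) h h' e = +-cong (sum-cong n h h' (λ j le → e j (NP.m≤n⇒m≤1+n le))) (e (suc n) NP.≤-refl)

  sum-first : ∀ n (h : ℕ → Carrier) → sumTo (suc n) h ≈ h 0 + sumTo n (λ j → h (suc j))
  sum-first zero    h = refl
  sum-first (suc n) h = trans (+-congʳ (sum-first n h)) (+-assoc _ _ _)

  sum-+ : ∀ n (f g : ℕ → Carrier) → sumTo n (λ j → f j + g j) ≈ sumTo n f + sumTo n g
  sum-+ zero    f g = refl
  sum-+ (suc n) f g = trans (+-congʳ (sum-+ n f g))
    (solve 4 (λ a b x y → ((a ⊕ b) ⊕ (x ⊕ y)) ⊜ ((a ⊕ x) ⊕ (b ⊕ y))) refl _ _ _ _)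

  sum-* : ∀ n r (f : ℕ → Carrier) → sumTo n (λ j → r * f j) ≈ r * sumTo n f
  sum-* zero    r f = refl
  sum-* (suc n) r f = trans (+-congʳ (sum-* n r f)) (sym (distribˡ r _ _))

  sum-0 : ∀ n (h : ℕ → Carrier) → (∀ j → j N.≤ n → h j ≈ 0#) → sumTo n h ≈ 0#
  sum-0 zero    h e = e 0 z≤n
  sum-0 (suc n) h e =
    trans (+-cong (sum-0 n h (λ j le → e j (NP.m≤n⇒m≤1+n le))) (e (suc n) NP.≤-refl)) (+-identityˡ 0#)

  -- Summing in reverse order; this gives commutativity of the Cauchy product.
  sum-rev : ∀ n (h : ℕ → Carrier) → sumTo n h ≈ sumTo n (λ j → h (n ∸ j))
  sum-rev zero    h = refl
  sum-rev (suc n) h = sym (begin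
    sumTo (suc n) (λ j → h (suc n ∸ j)) ≈⟨ sum-first n (λ j → h (suc n ∸ j)) ⟩
    h (suc n) + sumTo n (λ j → h (n ∸ j)) ≈⟨ +-congˡ (sym (sum-rev n h)) ⟩
    h (suc n) + sumTo n h                 ≈⟨ +-comm _ _ ⟩
    sumTo n h + h (suc n)                 ∎)

  conv-cong≤ : ∀ i (f f' g g' : Series) → (∀ j → j N.≤ i → f j ≈ f' j) → (∀ j → j N.≤ i → g j ≈ g' j) →
    conv f g i ≈ conv f' g' i
  conv-cong≤ i f f' g g' ef eg = sum-cong i _ _ (λ j le → *-cong (ef j le) (eg (i ∸ j) (NP.m∸n≤m i j)))

  conv-cong : ∀ (f f' g g' : Series) → (∀ j → f j ≈ f' j) → (∀ j → g j ≈ g' j) → ∀ i →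
    conv f g i ≈ conv f' g' i
  conv-cong f f' g g' ef eg i = conv-cong≤ i f f' g g' (λ j _ → ef j) (λ j _ → eg j)

  conv-comm : ∀ (f g : Series) i → conv f g i ≈ conv g f i
  conv-comm f g i = begin
    conv f g i                                     ≈⟨ sum-rev i _ ⟩
    sumTo i (λ j → f (i ∸ j) * g (i ∸ (i ∸ j)))  ≈⟨ sum-cong i _ _ (λ j le →
       trans (*-comm _ _) (*-congʳ (reflexive (PE.cong g (NP.m∸[m∸n]≡n le))))) ⟩
    conv g f i                                     ∎

  conv-suc : ∀ (f g : Series) i → conv f g (suc i) ≈ f 0 * g (suc i) + conv (λ j → f (suc j)) g i
  conv-suc f g i = sum-first i _

  conv-+ : ∀ (f g h : Series) i → conv (λ j → f j + g j) h i ≈ conv f h i + conv g h i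
  conv-+ f g h i = trans (sum-cong i _ _ (λ j _ → distribʳ _ _ _)) (sum-+ i _ _)

  conv-* : ∀ r (f h : Series) i → conv (λ j → r * f j) h i ≈ r * conv f h i
  conv-* r f h i = trans (sum-cong i _ _ (λ j _ → *-assoc _ _ _)) (sum-* i r _)

  conv-*ʳ : ∀ r (f g : Series) i → conv f (λ j → r * g j) i ≈ r * conv f g i
  conv-*ʳ r f g i = trans (conv-comm f _ i) (trans (conv-* r g f i) (*-congˡ (conv-comm g f i)))

  conv-assoc : ∀ i (f g h : Series) → conv (conv f g) h i ≈ conv f (conv g h) i
  conv-assoc zero    f g h = *-assoc _ _ _
  conv-assoc (suc i) f g h = begin
    conv (conv f g) h (suc i)
      ≈⟨ conv-suc (conv f g) h i ⟩
    (f 0 * g 0) * h (suc i) + conv (λ j → conv f g (suc j)) h i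
      ≈⟨ +-congˡ (conv-cong _ _ h h (λ j → conv-suc f g j) (λ _ → refl) i) ⟩
    (f 0 * g 0) * h (suc i) + conv (λ j → f 0 * g (suc j) + conv f' g j) h i
      ≈⟨ +-congˡ (conv-+ _ _ h i) ⟩
    (f 0 * g 0) * h (suc i) + (conv (λ j → f 0 * g (suc j)) h i + conv (conv f' g) h i)
      ≈⟨ +-congˡ (+-cong (conv-* (f 0) (λ j → g (suc j)) h i) (conv-assoc i f' g h)) ⟩
    (f 0 * g 0) * h (suc i) + (f 0 * conv (λ j → g (suc j)) h i + conv f' (conv g h) i)
      ≈⟨ sym (trans (+-congʳ (trans (distribˡ _ _ _) (+-congʳ (sym (*-assoc _ _ _))))) (+-assoc _ _ _)) ⟩
    f 0 * (g 0 * h (suc i) + conv (λ j → g (suc j)) h i) + conv f' (conv g h) i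
      ≈⟨ +-congʳ (*-congˡ (sym (conv-suc g h i))) ⟩
    f 0 * conv g h (suc i) + conv f' (conv g h) i
      ≈⟨ sym (conv-suc f (conv g h) i) ⟩
    conv f (conv g h) (suc i) ∎
    where
    f' : Series
    f' j = f (suc j)

  conv-const : ∀ r (f : Series) i → conv (const r) f i ≈ r * f i
  conv-const r f zero    = refl
  conv-const r f (suc i) = begin
    conv (const r) f (suc i)             ≈⟨ conv-suc (const r) f i ⟩
    r * f (suc i) + conv (λ _ → 0#) f i  ≈⟨ +-congˡ (sum-0 i _ (λ j _ → zeroˡ _)) ⟩
    r * f (suc i) + 0#                   ≈⟨ +-identityʳ _ ⟩
    r * f (suc i)                        ∎

  conv-zero : ∀ (f g : Series) i → (∀ j → j N.≤ i → (f j ≈ 0#) ⊎ (g (i ∸ j) ≈ 0#)) → conv f g i ≈ 0#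
  conv-zero f g i e = sum-0 i _ (λ j le → product-zero (e j le))
    where
    product-zero : ∀ {j} → (f j ≈ 0#) ⊎ (g (i ∸ j) ≈ 0#) → f j * g (i ∸ j) ≈ 0#
    product-zero (inj₁ fj≈0) = trans (*-congʳ fj≈0) (zeroˡ _)
    product-zero (inj₂ gk≈0) = trans (*-congˡ gk≈0) (zeroʳ _)

  conv-vanish : ∀ (f g : Series) p q → (∀ j → p N.< j → f j ≈ 0#) → (∀ k → q N.≤ k → g k ≈ 0#) →
    ∀ i → p N.+ q N.≤ i → conv f g i ≈ 0#
  conv-vanish f g p q fv gv i p+q≤i = conv-zero f g i vanishing
    where
    vanishing : ∀ j → j N.≤ i → (f j ≈ 0#) ⊎ (g (i ∸ j) ≈ 0#)
    vanishing j _ with j N.≤? p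
    ... | yes j≤p = inj₂ (gv (i ∸ j) (NP.m+n≤o⇒m≤o∸n q (NP.≤-trans (NP.+-monoʳ-≤ q j≤p)
                      (NP.≤-trans (NP.≤-reflexive (NP.+-comm q p)) p+q≤i))))
    ... | no j≰p  = inj₁ (fv j (NP.≰⇒> j≰p))

  Eventually : ∀ {z} → (Carrier → Set z) → Series → Set z
  Eventually P w = ∃ λ n → ∀ i → n N.≤ i → P (w i)

  lincomb : Series → Series → Series → Series → Series
  lincomb U C V D i = conv U C i + conv V D i

  lincomb-finite : (u c v d : Poly) → Eventually (_≈ 0#) (lincomb (coeff u) (coeff c) (coeff v) (coeff d))
  lincomb-finite u c v d = (bound u N.+ bound c) N.+ (bound v N.+ bound d) , λ i le →
      trans (+-cong (finite u c i (NP.≤-trans (NP.m≤m+n _ _) le))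
                    (finite v d i (NP.≤-trans (NP.m≤n+m _ (bound u N.+ bound c)) le)))
            (+-identityʳ 0#)
    where
    finite : (f g : Poly) → ∀ i → bound f N.+ bound g N.≤ i → conv (coeff f) (coeff g) i ≈ 0#
    finite f g = conv-vanish (coeff f) (coeff g) (bound f) (bound g)
                   (λ j lt → vanish f j (NP.<⇒≤ lt)) (vanish g)

  lincomb-assoc : ∀ (U A V B X : Series) i →
    conv (lincomb U A V B) X i ≈ conv U (conv A X) i + conv V (conv B X) i
  lincomb-assoc U A V B X i = trans (conv-+ _ _ X i) (+-cong (conv-assoc i U A X) (conv-assoc i V B X))

  scale-by-combination : ∀ r (U V A B C D : Series) → (∀ i → lincomb U A V B i ≈ const r i) →
    (∀ i → conv A D i ≈ conv B C i) → ∀ i → r * C i ≈ conv A (lincomb U C V D) i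
  scale-by-combination r U V A B C D uv ad i = begin
    r * C i                                    ≈⟨ sym (conv-const r C i) ⟩
    conv (const r) C i                         ≈⟨ conv-cong _ _ C C (λ j → sym (uv j)) (λ _ → refl) i ⟩
    conv (lincomb U A V B) C i                 ≈⟨ lincomb-assoc U A V B C i ⟩
    conv U (conv A C) i + conv V (conv B C) i  ≈⟨ +-cong (conv-cong U U _ _ (λ _ → refl) (conv-comm A C) i)
                                                         (conv-cong V V _ _ (λ _ → refl) bc≈da i) ⟩
    conv U (conv C A) i + conv V (conv D A) i  ≈⟨ sym (lincomb-assoc U C V D A i) ⟩
    conv (lincomb U C V D) A i                 ≈⟨ conv-comm _ A i ⟩
    conv A (lincomb U C V D) i                 ∎
    where
    bc≈da : ∀ j → conv B C j ≈ conv D A j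
    bc≈da j = trans (sym (ad j)) (conv-comm A D j)

  combination-quotient : ∀ r (U V A B C D : Series) → (∀ i → lincomb U A V B i ≈ const r i) →
    (∀ i → conv A D i ≈ conv B C i) →
    (∀ i → r * C i ≈ conv A (lincomb U C V D) i) × (∀ i → r * D i ≈ conv B (lincomb U C V D) i)
  combination-quotient r U V A B C D uv ad =
      scale-by-combination r U V A B C D uv ad
    , λ i → trans (scale-by-combination r V U B A D C (λ j → trans (+-comm _ _) (uv j)) (λ j → sym (ad j)) i)
                  (conv-cong B B (lincomb V D U C) (lincomb U C V D) (λ _ → refl) (λ j → +-comm _ _) i)

  topIndex : ∀ {z} (Q : ℕ → Set z) → (∀ i → Dec (Q i)) → ∀ B → (∀ i → B N.≤ i → Q i) →
    (∀ i → Q i) ⊎ (∃ λ j → ¬ Q j × (∀ i → j N.< i → Q i))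
  topIndex Q dec zero    holds = inj₁ (λ i → holds i z≤n)
  topIndex Q dec (suc B) holds with dec B
  ... | no ¬QB = inj₂ (B , ¬QB , holds)
  ... | yes QB = topIndex Q dec B holds-from-B
    where
    holds-from-B : ∀ i → B N.≤ i → Q i
    holds-from-B i le with NP.m≤n⇒m<n∨m≡n le
    ... | inj₁ lt      = holds i lt
    ... | inj₂ PE.refl = QB

  -- Ideals of R with decidable membership; x ~ y is congruence modulo the ideal.
  -- Both the ideal 2R and the zero ideal are used, the latter for exact statements.
  record DecIdeal z : Set (ℓ₁ ⊔ ℓ₂ ⊔ Level.suc z) where
    field
      In      : Carrier → Set z
      In-resp : ∀ {x y} → x ≈ y → In x → In y
      In-0    : In 0#
      In-+    : ∀ {x y} → In x → In y → In (x + y)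
      In-*    : ∀ x {y} → In y → In (x * y)
      In-dec  : ∀ x → Dec (In x)

    infix 4 _~_
    _~_ : Carrier → Carrier → Set z
    x ~ y = In (x - y)

    In-≈0 : ∀ {x} → x ≈ 0# → In x
    In-≈0 e = In-resp (sym e) In-0

    ~-reflexive : ∀ {x y} → x ≈ y → x ~ y
    ~-reflexive e = In-≈0 (x≈y⇒x∙y⁻¹≈ε e)

    ~-sym : ∀ {x y} → x ~ y → y ~ x
    ~-sym p = In-resp (trans (-1*x≈-x _) (⁻¹-anti-homo‿- _ _)) (In-* (- 1#) p)

    ~-trans : ∀ {x y w} → x ~ y → y ~ w → x ~ w
    ~-trans {x} {y} {w} p q = In-resp difference (In-+ p q)
      where
      difference : (x - y) + (y - w) ≈ x - w
      difference = trans (sym (+-assoc _ _ _))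
        (+-congʳ (trans (+-assoc _ _ _) (trans (+-congˡ (-‿inverseˡ y)) (+-identityʳ x))))

    ~-*ˡ : ∀ r {x y} → x ~ y → r * x ~ r * y
    ~-*ˡ r p = In-resp (x[y-z]≈xy-xz r _ _) (In-* r p)

    In-~ : ∀ {x y} → x ~ y → In x → In y
    In-~ {x} {y} p x∈ = In-resp cancel (In-+ (~-sym p) x∈)
      where
      cancel : (y - x) + x ≈ y
      cancel = trans (+-assoc _ _ _) (trans (+-congˡ (-‿inverseˡ x)) (+-identityʳ y))

    In-unit : ∀ {u y} → IsUnit u → In (u * y) → In y
    In-unit {u} {y} (v , uv≈1) uy∈ = In-resp cancel (In-* v uy∈)
      where
      cancel : v * (u * y) ≈ y
      cancel = trans (sym (*-assoc v u y)) (trans (*-congʳ (trans (*-comm v u) uv≈1)) (*-identityˡ y))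

    rescale : ∀ {ν w₀ C F} → ν * w₀ ≈ 1# → C ~ F * w₀ → F ~ ν * C
    rescale {ν} {w₀} {C} {F} νw₀≈1 C~Fw₀ = ~-sym (~-trans (~-*ˡ ν C~Fw₀) (~-reflexive cancel))
      where
      cancel : ν * (F * w₀) ≈ F
      cancel = trans (*-comm _ _) (trans (*-assoc _ _ _) (trans (*-congˡ (trans (*-comm w₀ ν) νw₀≈1)) (*-identityʳ _)))

    sum-In : ∀ n (h : ℕ → Carrier) → (∀ j → j N.≤ n → In (h j)) → In (sumTo n h)
    sum-In zero    h e = e 0 z≤n
    sum-In (suc n) h e = In-+ (sum-In n h (λ j le → e j (NP.m≤n⇒m≤1+n le))) (e (suc n) NP.≤-refl)

    sum-single : ∀ n (h : ℕ → Carrier) l → l N.≤ n → (∀ j → j N.≤ n → j ≢ l → In (h j)) → sumTo n h ~ h l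
    sum-single zero    h .0 z≤n e = ~-reflexive refl
    sum-single (suc n) h l  le e with l N.≟ suc n
    ... | yes PE.refl = In-resp (sym (trans (+-assoc _ _ _) (trans (+-congˡ (-‿inverseʳ _)) (+-identityʳ _))))
                          (sum-In n h (λ j le' → e j (NP.m≤n⇒m≤1+n le') (λ eq → NP.<-irrefl eq (s≤s le'))))
    ... | no l≢1+n    = In-resp (solve 3 (λ S hl hn → ((S ⊕ hn) ⊕ hl) ⊜ ((S ⊕ hl) ⊕ hn)) refl _ _ _)
                          (In-+ (sum-single n h l (NP.≤-pred (NP.≤∧≢⇒< le l≢1+n))
                                   (λ j le' j≢l → e j (NP.m≤n⇒m≤1+n le') j≢l))
                                (e (suc n) NP.≤-refl (λ eq → l≢1+n (PE.sym eq))))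

    conv-In : ∀ (f g : Series) i → (∀ k → In (g k)) → In (conv f g i)
    conv-In f g i g∈ = sum-In i _ (λ j _ → In-* (f j) (g∈ _))

    conv-top : ∀ (f g : Series) n j → (∀ i → n N.< i → f i ≈ 0#) → (∀ i → j N.< i → In (g i)) →
      conv f g (j N.+ n) ~ f n * g j
    conv-top f g n j fv g∈ =
      In-resp (+-congˡ (-‿cong (*-congˡ (reflexive (PE.cong g (NP.m+n∸n≡m j n))))))
        (sum-single (j N.+ n) (λ l → f l * g ((j N.+ n) ∸ l)) n (NP.m≤n+m n j) others)
      where
      others : ∀ l → l N.≤ j N.+ n → l ≢ n → In (f l * g ((j N.+ n) ∸ l))
      others l le l≢n with NP.<-cmp l n
      ... | tri< l<n _ _ = In-* (f l) (g∈ _ (NP.m+n≤o⇒m≤o∸n (suc j)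
                             (PE.subst (N._≤ j N.+ n) (NP.+-suc j l) (NP.+-monoʳ-≤ j l<n))))
      ... | tri≈ _ l≡n _ = ⊥-elim (l≢n l≡n)
      ... | tri> _ _ n<l = In-≈0 (trans (*-congʳ (fv l n<l)) (zeroˡ _))

    conv-constant : ∀ (f g : Series) i → (∀ k → 0 N.< k → In (g k)) → conv f g i ~ f i * g 0
    conv-constant f g i g∈ =
      In-resp (+-congˡ (-‿cong (*-congˡ (reflexive (PE.cong g (NP.n∸n≡0 i))))))
        (sum-single i (λ l → f l * g (i ∸ l)) i NP.≤-refl
          (λ l le l≢i → In-* (f l) (g∈ _ (NP.m+n≤o⇒m≤o∸n 1 (NP.≤∧≢⇒< le l≢i)))))

  <T-trans : ∀ {τ σ ρ} → τ <T σ → σ <T ρ → τ <T ρ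
  <T-trans (ff p) (ff q) = ff (NP.<-trans p q)
  <T-trans (ff p) (fs q) = fs (λ r → q (NP.≤-trans r (NP.<⇒≤ p)))
  <T-trans (ss p) (ss q) = ss (NP.<-trans p q)
  <T-trans (ss p) (sf q) = sf (NP.≤-trans p (NP.≤-trans (NP.n≤1+n _) q))
  <T-trans (sf p) (ff q) = sf (NP.≤-trans p (NP.<⇒≤ q))
  <T-trans (sf p) (fs q) = ss (NP.≰⇒> λ r → q (NP.≤-trans (s≤s r) p))
  <T-trans (fs p) (ss q) = fs (λ r → p (NP.≤-trans (NP.<⇒≤ (s≤s q)) r))
  <T-trans (fs p) (sf q) = ff (NP.≰⇒> λ r → p (NP.≤-trans q r))

  ≤T-or->T : ∀ τ σ → τ ≤T σ ⊎ σ <T τ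
  ≤T-or->T (fstT i) (fstT j) with NP.<-cmp i j
  ... | tri< lt _ _      = inj₁ (inj₁ (ff lt))
  ... | tri≈ _ PE.refl _ = inj₁ (inj₂ PE.refl)
  ... | tri> _ _ gt      = inj₂ (ff gt)
  ≤T-or->T (sndT i) (sndT j) with NP.<-cmp i j
  ... | tri< lt _ _      = inj₁ (inj₁ (ss lt))
  ... | tri≈ _ PE.refl _ = inj₁ (inj₂ PE.refl)
  ... | tri> _ _ gt      = inj₂ (ss gt)
  ≤T-or->T (fstT i) (sndT j) with suc j N.≤? i
  ... | yes p = inj₂ (sf p)
  ... | no p  = inj₁ (inj₁ (fs p))
  ≤T-or->T (sndT j) (fstT i) with suc j N.≤? i
  ... | yes p = inj₁ (inj₁ (sf p))
  ... | no p  = inj₂ (fs p)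

  <≤T-trans : ∀ {τ σ ρ} → τ <T σ → σ ≤T ρ → τ <T ρ
  <≤T-trans p (inj₁ q)       = <T-trans p q
  <≤T-trans p (inj₂ PE.refl) = p

  ≤<T-trans : ∀ {τ σ ρ} → τ ≤T σ → σ <T ρ → τ <T ρ
  ≤<T-trans (inj₁ p)       q = <T-trans p q
  ≤<T-trans (inj₂ PE.refl) q = q

  component : Term → Series → Series → Series
  component (fstT _) F G = F
  component (sndT _) F G = G

  idx : Term → ℕ
  idx (fstT n) = n
  idx (sndT n) = n

  component-preserves : ∀ {z} (P : Carrier → Set z) τ {F G : Series} →
    (∀ i → P (F i)) → (∀ i → P (G i)) → ∀ i → P (component τ F G i)
  component-preserves P (fstT _) PF PG = PF
  component-preserves P (sndT _) PF PG = PG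

  -- A pair with no terms above [z^n,0] has second component of degree < n; with none above
  -- [0,z^k], of degree ≤ k.  In both cases it vanishes from index sndEdge τ on.
  sndEdge : Term → ℕ
  sndEdge (fstT n) = n
  sndEdge (sndT k) = suc k

  shift : Term → ℕ → Term
  shift (fstT n) j = fstT (j N.+ n)
  shift (sndT n) j = sndT (j N.+ n)

  shift-coeff : ∀ τ j (c d : Poly) → coeffT c d (shift τ j) ≡ component τ (coeff c) (coeff d) (j N.+ idx τ)
  shift-coeff (fstT n) j c d = PE.refl
  shift-coeff (sndT n) j c d = PE.refl

  shift-> : ∀ τ j → τ <T shift τ (suc j)
  shift-> (fstT n) j = ff (s≤s (NP.m≤n+m n j))
  shift-> (sndT n) j = ss (s≤s (NP.m≤n+m n j))

  shift-≤ : ∀ τ j → τ ≤T shift τ j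
  shift-≤ (fstT n) zero    = inj₂ PE.refl
  shift-≤ (sndT n) zero    = inj₂ PE.refl
  shift-≤ τ        (suc j) = inj₁ (shift-> τ j)

  VanAbove : Poly → Poly → Term → Set ℓ₂
  VanAbove c d τ = ∀ σ → τ <T σ → coeffT c d σ ≈ 0#

  vanish-split : (c d : Poly) → ∀ τ → VanAbove c d τ →
    (∀ i → idx τ N.< i → coeff c i ≈ 0#) × (∀ i → sndEdge τ N.≤ i → coeff d i ≈ 0#)
  vanish-split c d (fstT n) van =
    (λ i n<i → van (fstT i) (ff n<i)) , (λ i n≤i → van (sndT i) (fs (λ i<n → NP.n≮n i (NP.≤-trans i<n n≤i))))
  vanish-split c d (sndT k) van = (λ i k<i → van (fstT i) (sf k<i)) , (λ i k<i → van (sndT i) (ss k<i))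

  lead-vanish : (c d : Poly) → ∀ τ → VanAbove c d τ → ∀ i → idx τ N.< i → component τ (coeff c) (coeff d) i ≈ 0#
  lead-vanish c d (fstT n) van = proj₁ (vanish-split c d (fstT n) van)
  lead-vanish c d (sndT k) van = proj₂ (vanish-split c d (sndT k) van)

  lt-bounds : ∀ {c d σ τ} → IsLT c d σ → σ ≤T τ → VanAbove c d τ
  lt-bounds ltc σ≤τ ρ τ<ρ = proj₂ ltc ρ (≤<T-trans σ≤τ τ<ρ)

  shift-zero : (c d : Poly) → ∀ τ j → VanAbove c d τ → ¬ (coeffT c d (shift τ j) ≈ 0#) → j ≡ 0
  shift-zero c d τ zero    van nz = PE.refl
  shift-zero c d τ (suc j) van nz = ⊥-elim (nz (van _ (shift-> τ j)))

  module LeadingTerms (_≟0 : ∀ x → Dec (x ≈ 0#)) where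

    top-coefficient : (c : Poly) →
      (∀ i → coeff c i ≈ 0#) ⊎ (∃ λ j → ¬ (coeff c j ≈ 0#) × (∀ i → j N.< i → coeff c i ≈ 0#))
    top-coefficient c = topIndex (λ i → coeff c i ≈ 0#) (λ i → coeff c i ≟0) (bound c) (vanish c)

    lt-exist : (c d : Poly) → ¬ (∀ i → (coeff c i ≈ 0#) × (coeff d i ≈ 0#)) → ∃ (IsLT c d)
    lt-exist c d nz with top-coefficient c | top-coefficient d
    ... | inj₁ c≈0 | inj₁ d≈0 = ⊥-elim (nz (λ i → c≈0 i , d≈0 i))
    ... | inj₁ c≈0 | inj₂ (k , dk≉0 , above) =
      sndT k , dk≉0 , λ { (fstT i) _ → c≈0 i ; (sndT i) (ss lt) → above i lt }
    ... | inj₂ (n , cn≉0 , above) | inj₁ d≈0 =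
      fstT n , cn≉0 , λ { (fstT i) (ff lt) → above i lt ; (sndT i) _ → d≈0 i }
    ... | inj₂ (n , cn≉0 , aboveC) | inj₂ (k , dk≉0 , aboveD) with suc k N.≤? n
    ... | yes k<n = fstT n , cn≉0 , λ { (fstT i) (ff lt) → aboveC i lt
                                        ; (sndT i) (fs q) → aboveD i (NP.≤-trans k<n (NP.≤-pred (NP.≰⇒> q))) }
    ... | no k≮n  = sndT k , dk≉0 , λ { (sndT i) (ss lt) → aboveD i lt
                                        ; (fstT i) (sf q) → aboveC i (NP.<-≤-trans (NP.≰⇒> k≮n) q) }

  module GR4 {m : ℕ} (gr : IsGR4 m) where
    open IsGR4 gr

    two*two≈0 : two * two ≈ 0#
    two*two≈0 = trans (distribˡ two 1# 1#) (trans (+-cong (*-identityʳ two) (*-identityʳ two)) char4)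

    unit∉2R : ∀ {x} → IsUnit x → ¬ In2R x
    unit∉2R {x} (y , xy≈1) (z , x≈2z) = two≉0 (begin
      two                    ≈⟨ sym (*-identityʳ two) ⟩
      two * 1#               ≈⟨ *-congˡ (sym xy≈1) ⟩
      two * (x * y)          ≈⟨ *-congˡ (*-congʳ x≈2z) ⟩
      two * ((two * z) * y)  ≈⟨ *-congˡ (*-assoc _ _ _) ⟩
      two * (two * (z * y))  ≈⟨ sym (*-assoc _ _ _) ⟩
      (two * two) * (z * y)  ≈⟨ *-congʳ two*two≈0 ⟩
      0# * (z * y)           ≈⟨ zeroˡ _ ⟩
      0#                     ∎)

    ¬2R⇒unit : ∀ {x} → ¬ In2R x → IsUnit x
    ¬2R⇒unit {x} x∉2R with local2 x
    ... | inj₁ unit = unit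
    ... | inj₂ x∈2R = ⊥-elim (x∉2R x∈2R)

    twoZero⇒2R : ∀ {x} → two * x ≈ 0# → In2R x
    twoZero⇒2R {x} 2x≈0 with local2 x
    ... | inj₂ x∈2R     = x∈2R
    ... | inj₁ (y , xy≈1) = ⊥-elim (two≉0 (begin
      two            ≈⟨ sym (*-identityʳ two) ⟩
      two * 1#       ≈⟨ *-congˡ (sym xy≈1) ⟩
      two * (x * y)  ≈⟨ sym (*-assoc _ _ _) ⟩
      (two * x) * y  ≈⟨ *-congʳ 2x≈0 ⟩
      0# * y         ≈⟨ zeroˡ _ ⟩
      0#             ∎))

    two-cancel : ∀ {x y} → two * x ≈ two * y → x ≈K y
    two-cancel e = twoZero⇒2R (trans (x[y-z]≈xy-xz _ _ _) (x≈y⇒x∙y⁻¹≈ε e))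

    -- R is finite, so equality is decidable through the enumeration.
    _≟0 : ∀ x → Dec (x ≈ 0#)
    x ≟0 with enum-onto x | enum-onto 0#
    ... | i , x≈i | j , 0≈j with i FP.≟ j
    ... | yes PE.refl = yes (trans x≈i (sym 0≈j))
    ... | no i≢j      = no (λ x≈0 → i≢j (enum-inj i j (trans (sym x≈i) (trans x≈0 0≈j))))

    open LeadingTerms _≟0 public

    dec2R : ∀ x → Dec (In2R x)
    dec2R x with local2 x
    ... | inj₂ x∈2R = yes x∈2R
    ... | inj₁ unit = no (unit∉2R unit)

    ideal2R : DecIdeal (ℓ₁ ⊔ ℓ₂)
    ideal2R = record
      { In      = In2R
      ; In-resp = λ { e (y , x≈2y) → y , trans (sym e) x≈2y }
      ; In-0    = 0# , sym (zeroʳ two)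
      ; In-+    = λ { (y , p) (y' , p') → y + y' , trans (+-cong p p') (sym (distribˡ _ _ _)) }
      ; In-*    = λ { x (y , p) → x * y , trans (*-congˡ p)
                        (trans (sym (*-assoc _ _ _)) (trans (*-congʳ (*-comm x two)) (*-assoc _ _ _))) }
      ; In-dec  = dec2R
      }

    ideal0 : DecIdeal ℓ₂
    ideal0 = record
      { In      = _≈ 0#
      ; In-resp = λ e x≈0 → trans (sym e) x≈0
      ; In-0    = refl
      ; In-+    = λ x≈0 y≈0 → trans (+-cong x≈0 y≈0) (+-identityˡ 0#)
      ; In-*    = λ x y≈0 → trans (*-congˡ y≈0) (zeroʳ x)
      ; In-dec  = _≟0
      }

    module Mod2 = DecIdeal ideal2R
    module Mod0 = DecIdeal ideal0

    -- A pair whose coefficients all lie in 2R lies in 2R[z]²: halve coefficientwise, choosing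
    -- 0 as the half of 0 so that the halves still have finite support.
    in2Poly : (c d : Poly) → (∀ i → In2R (coeff c i) × In2R (coeff d i)) → In2Poly c d
    in2Poly c d even = half c (λ i → proj₁ (even i)) , half d (λ i → proj₂ (even i)) ,
                       (λ i → half-ok (coeff c i) _) , (λ i → half-ok (coeff d i) _)
      where
      halve : (x : Carrier) → Dec (x ≈ 0#) → In2R x → Carrier
      halve x (yes _) _         = 0#
      halve x (no _)  (y , _)   = y

      half-ok : ∀ x (p : In2R x) → x ≈ two * halve x (x ≟0) p
      half-ok x p with x ≟0
      ... | yes x≈0 = trans x≈0 (sym (zeroʳ two))
      ... | no _    = proj₂ p

      half : (p : Poly) → (∀ i → In2R (coeff p i)) → Poly
      half p ev = record
        { coeff  = λ i → halve (coeff p i) (coeff p i ≟0) (ev i)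
        ; bound  = bound p
        ; vanish = halves-vanish
        }
        where
        halves-vanish : ∀ i → bound p N.≤ i → halve (coeff p i) (coeff p i ≟0) (ev i) ≈ 0#
        halves-vanish i le with coeff p i ≟0
        ... | yes _   = refl
        ... | no p≉0  = ⊥-elim (p≉0 (vanish p i le))

    module Setting (t : ℕ) (T : Series) (a b : Poly) (inM : InM t T a b)
      (deg-a : ∀ i → suc t N.< 2 N.* i → coeff a i ≈ 0#)
      (deg-b : ∀ i → t N.< 2 N.* i → coeff b i ≈ 0#)
      (lc-a : ∀ n → IsDeg a n → (∀ i → n N.≤ i → coeff b i ≈ 0#) → IsUnit (coeff a n))
      (lc-b : ∀ k → IsDeg b k → (∀ i → k N.< i → coeff a i ≈ 0#) → IsUnit (coeff b k)) where

      A B : Series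
      A = coeff a
      B = coeff b

      lead-unit : ∀ τ → IsLT a b τ → IsUnit (component τ A B (idx τ))
      lead-unit (fstT n) (nz , van) = lc-a n (nz , proj₁ split) (proj₂ split)
        where split = vanish-split a b (fstT n) van
      lead-unit (sndT k) (nz , van) = lc-b k (nz , proj₂ split) (proj₁ split)
        where split = vanish-split a b (sndT k) van

      lead-bound : ∀ τ → IsLT a b τ → idx τ N.+ sndEdge τ N.≤ suc t
      lead-bound (fstT n) (nz , _) =
        NP.≤-trans (NP.≤-reflexive (PE.cong (n N.+_) (PE.sym (NP.+-identityʳ n))))
                   (NP.≮⇒≥ (λ lt → nz (deg-a n lt)))
      lead-bound (sndT k) (nz , _) =
        NP.≤-trans (NP.≤-reflexive (NP.+-suc k k))
                   (s≤s (NP.≤-trans (NP.≤-reflexive (PE.cong (k N.+_) (PE.sym (NP.+-identityʳ k))))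
                                    (NP.≮⇒≥ (λ lt → nz (deg-b k lt)))))

      cross-multiplication : ∀ τ → IsLT a b τ → (c d : Poly) → InM t T c d → VanAbove c d τ →
        ∀ i → conv A (coeff d) i ≈ conv B (coeff c) i
      cross-multiplication τ lt c d inMc van i with i N.≤? t
      ... | yes i≤t = begin
        conv A D i                       ≈⟨ conv-cong≤ i A A _ _ (λ _ _ → refl) (λ j j≤i → sym (inMc j (below j≤i))) ⟩
        conv A (conv C (onePlus T)) i    ≈⟨ conv-cong A A _ _ (λ _ → refl) (conv-comm C (onePlus T)) i ⟩
        conv A (conv (onePlus T) C) i    ≈⟨ sym (conv-assoc i A (onePlus T) C) ⟩
        conv (conv A (onePlus T)) C i    ≈⟨ conv-cong≤ i _ B C C (λ j j≤i → inM j (below j≤i)) (λ _ _ → refl) ⟩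
        conv B C i                       ∎
        where
        C = coeff c
        D = coeff d
        below : ∀ {j} → j N.≤ i → j N.≤ t
        below j≤i = NP.≤-trans j≤i i≤t
      ... | no i≰t = begin
        conv A (coeff d) i  ≈⟨ conv-vanish A (coeff d) (idx τ) (sndEdge τ) (proj₁ ab-split) (proj₂ cd-split) i high ⟩
        0#                  ≈⟨ sym (conv-vanish (coeff c) B (idx τ) (sndEdge τ) (proj₁ cd-split) (proj₂ ab-split) i high) ⟩
        conv (coeff c) B i  ≈⟨ conv-comm (coeff c) B i ⟩
        conv B (coeff c) i  ∎
        where
        ab-split = vanish-split a b τ (proj₂ lt)
        cd-split = vanish-split c d τ van
        high : idx τ N.+ sndEdge τ N.≤ i
        high = NP.≤-trans (lead-bound τ lt) (NP.≰⇒> i≰t)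

      module Division {z} (I : DecIdeal z) where
        open DecIdeal I

        Multiple : Series → Series → Series → Set z
        Multiple C D w = (∀ i → C i ~ conv A w i) × (∀ i → D i ~ conv B w i)

        Quotient : Poly → Poly → Set (ℓ₁ ⊔ z)
        Quotient c d = Σ Series λ w → Eventually In w × Multiple (coeff c) (coeff d) w

        AllIn : Poly → Poly → Set z
        AllIn c d = ∀ i → In (coeff c i) × In (coeff d i)

        ¬AllIn⇒nonzero : (c d : Poly) → ¬ AllIn c d → ¬ (∀ i → (coeff c i ≈ 0#) × (coeff d i ≈ 0#))
        ¬AllIn⇒nonzero c d ¬all all≈0 = ¬all (λ i → In-≈0 (proj₁ (all≈0 i)) , In-≈0 (proj₂ (all≈0 i)))

        component-multiple : ∀ τ {C D w} → Multiple C D w → ∀ i → component τ C D i ~ conv (component τ A B) w i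
        component-multiple (fstT _) (C~Aw , _) = C~Aw
        component-multiple (sndT _) (_ , D~Bw) = D~Bw

        -- If j is the top index with w_j ∉ I, then the coefficient of [C,D] at z^j·lt[a,b] is ∉ I:
        -- it is congruent to lc·w_j, and lc is a unit.
        lead-division : ∀ τ → IsLT a b τ → ∀ {C D w} → Multiple C D w → ∀ j → ¬ In (w j) →
          (∀ i → j N.< i → In (w i)) → ¬ In (component τ C D (j N.+ idx τ))
        lead-division τ lt {C} {D} {w} mult j wj∉ above coeff∈ =
          wj∉ (In-unit (lead-unit τ lt)
                (In-~ (conv-top (component τ A B) w (idx τ) j (lead-vanish a b τ (proj₂ lt)) above)
                      (In-~ (component-multiple τ {C} {D} {w} mult (j N.+ idx τ)) coeff∈)))

        reduction : ∀ τ → IsLT a b τ → (c d : Poly) (w : Series) → Eventually In w → Multiple (coeff c) (coeff d) w →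
          AllIn c d ⊎ (∃ λ j → ¬ In (w j) × (∀ i → j N.< i → In (w i)) × ¬ In (coeffT c d (shift τ j)))
        reduction τ lt c d w (n , w∈) mult@(C~Aw , D~Bw) with topIndex (λ i → In (w i)) (λ i → In-dec (w i)) n w∈
        ... | inj₁ all∈ = inj₁ (λ i → In-~ (~-sym (C~Aw i)) (conv-In A w i all∈) ,
                                      In-~ (~-sym (D~Bw i)) (conv-In B w i all∈))
        ... | inj₂ (j , wj∉ , above) =
          inj₂ (j , wj∉ , above , λ coeff∈ →
                  lead-division τ lt mult j wj∉ above (PE.subst In (shift-coeff τ j c d) coeff∈))

        not-below : ∀ τ → IsLT a b τ → (c d : Poly) → Quotient c d → ¬ AllIn c d →
          ∀ σ → IsLT c d σ → ¬ σ <T τ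
        not-below τ lt c d (w , w-fin , mult) ¬all σ ltc σ<τ with reduction τ lt c d w w-fin mult
        ... | inj₁ all∈ = ¬all all∈
        ... | inj₂ (j , _ , _ , coeff∉) = coeff∉ (In-≈0 (proj₂ ltc (shift τ j) (<≤T-trans σ<τ (shift-≤ τ j))))

        ConstantMultiple : Poly → Poly → Set (ℓ₁ ⊔ z)
        ConstantMultiple c d = ∃ λ w₀ → ¬ In w₀ × (∀ i → coeff c i ~ A i * w₀) × (∀ i → coeff d i ~ B i * w₀)

        constant-quotient : ∀ τ → IsLT a b τ → (c d : Poly) → Quotient c d → ¬ AllIn c d → VanAbove c d τ →
          ConstantMultiple c d
        constant-quotient τ lt c d (w , w-fin , mult@(C~Aw , D~Bw)) ¬all van with reduction τ lt c d w w-fin mult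
        ... | inj₁ all∈ = ⊥-elim (¬all all∈)
        ... | inj₂ (j , wj∉ , above , coeff∉) with shift-zero c d τ j van (λ e → coeff∉ (In-≈0 e))
        ... | PE.refl = w 0 , wj∉ , (λ i → ~-trans (C~Aw i) (conv-constant A w i above))
                                 , (λ i → ~-trans (D~Bw i) (conv-constant B w i above))

        HasQuotients : Set (ℓ₁ ⊔ ℓ₂ ⊔ z)
        HasQuotients = ∀ τ → IsLT a b τ → (c d : Poly) → InM t T c d → VanAbove c d τ → Quotient c d

        module _ {s} (S : Poly → Poly → Set s) (S⊆ : ∀ c d → S c d → InM t T c d × ¬ AllIn c d)
                 (quotients : HasQuotients) (Sab : S a b) where

          minimal : Minimal S a b
          minimal = Sab , compare
            where
            compare : ∀ c d → S c d → ∀ τ σ → IsLT a b τ → IsLT c d σ → τ ≤T σ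
            compare c d Scd τ σ lta ltc with ≤T-or->T τ σ
            ... | inj₁ τ≤σ = τ≤σ
            ... | inj₂ σ<τ = ⊥-elim (not-below τ lta c d
                               (quotients τ lta c d (proj₁ (S⊆ c d Scd)) (lt-bounds ltc (inj₁ σ<τ)))
                               (proj₂ (S⊆ c d Scd)) σ ltc σ<τ)

          -- a minimal [c,d] has no terms above lt[a,b], so its quotient is constant
          unique : ∀ c d → Minimal S c d → ConstantMultiple c d
          unique c d (Scd , min) =
            constant-quotient τ lta c d (quotients τ lta c d (proj₁ (S⊆ c d Scd)) van) (proj₂ (S⊆ c d Scd)) van
            where
            ltab : ∃ (IsLT a b)
            ltab = lt-exist a b (¬AllIn⇒nonzero a b (proj₂ (S⊆ a b Sab)))
            τ = proj₁ ltab
            lta = proj₂ ltab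
            ltcd : ∃ (IsLT c d)
            ltcd = lt-exist c d (¬AllIn⇒nonzero c d (proj₂ (S⊆ c d Scd)))
            van : VanAbove c d τ
            van = lt-bounds (proj₂ ltcd) (min a b Sab (proj₁ ltcd) τ (proj₂ ltcd) lta)

      module Div2 = Division ideal2R
      module Div0 = Division ideal0

      -- If 2·[C,D] = w·[a,b] with w a polynomial, then w ∈ 2R[z]: otherwise the top coefficient
      -- of w outside 2R would produce a coefficient of 2·[C,D] outside 2R.
      quotient-even : ∀ τ → IsLT a b τ → (C D w : Series) → Eventually (_≈ 0#) w →
        (∀ i → two * C i ≈ conv A w i) → (∀ i → two * D i ≈ conv B w i) → ∀ i → In2R (w i)
      quotient-even τ lt C D w (n , w≈0) 2C≈Aw 2D≈Bw
        with topIndex (λ i → In2R (w i)) (λ i → dec2R (w i)) n (λ i le → Mod2.In-≈0 (w≈0 i le))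
      ... | inj₁ all-even = all-even
      ... | inj₂ (j , wj∉ , above) = ⊥-elim (Div2.lead-division τ lt multiple j wj∉ above
                                       (component-preserves In2R τ (λ i → C i , refl) (λ i → D i , refl) (j N.+ idx τ)))
        where
        multiple : Div2.Multiple (λ i → two * C i) (λ i → two * D i) w
        multiple = (λ i → Mod2.~-reflexive (2C≈Aw i)) , (λ i → Mod2.~-reflexive (2D≈Bw i))

      -- Part (a): with u·a + v·b = 2, every [c,d] ∈ M without terms above lt[a,b] is ≡ w'·[a,b]
      -- modulo 2, where 2w' = u·c + v·d.
      quotients-mod2 : InIdeal two a b → Div2.HasQuotients
      quotients-mod2 (u , v , uv≈2) τ lt c d inMc van =
        w' , (n , w'-even) , (λ i → halve A i (proj₁ scaled i)) , (λ i → halve B i (proj₂ scaled i))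
        where
        w = lincomb (coeff u) (coeff c) (coeff v) (coeff d)
        scaled : (∀ i → two * coeff c i ≈ conv A w i) × (∀ i → two * coeff d i ≈ conv B w i)
        scaled = combination-quotient two (coeff u) (coeff v) A B (coeff c) (coeff d) uv≈2
                   (cross-multiplication τ lt c d inMc van)
        w-fin = lincomb-finite u c v d
        n = proj₁ w-fin
        even : ∀ i → In2R (w i)
        even = quotient-even τ lt (coeff c) (coeff d) w w-fin (proj₁ scaled) (proj₂ scaled)
        w' : Series
        w' i = proj₁ (even i)
        w'-even : ∀ i → n N.≤ i → In2R (w' i)
        w'-even i le = twoZero⇒2R (trans (sym (proj₂ (even i))) (proj₂ w-fin i le))
        halve : ∀ (F : Series) i {x} → two * x ≈ conv F w i → x ≈K conv F w' i
        halve F i e = two-cancel (trans e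
          (trans (conv-cong F F w (λ j → two * w' j) (λ _ → refl) (λ j → proj₂ (even j)) i) (conv-*ʳ two F w' i)))

      quotients-exact : InIdeal 1# a b → Div0.HasQuotients
      quotients-exact (u , v , uv≈1) τ lt c d inMc van =
        w , lincomb-finite u c v d , (λ i → exact (proj₁ scaled i)) , (λ i → exact (proj₂ scaled i))
        where
        w = lincomb (coeff u) (coeff c) (coeff v) (coeff d)
        scaled : (∀ i → 1# * coeff c i ≈ conv A w i) × (∀ i → 1# * coeff d i ≈ conv B w i)
        scaled = combination-quotient 1# (coeff u) (coeff v) A B (coeff c) (coeff d) uv≈1
                   (cross-multiplication τ lt c d inMc van)
        exact : ∀ {x y} → 1# * x ≈ y → x Mod0.~ y
        exact e = Mod0.~-reflexive (trans (sym (*-identityˡ _)) e)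

      -- [a,b] ≠ 0, since 2 ≠ 0 lies in the ideal it generates.
      ab-nonzero : InIdeal two a b → ¬ (∀ i → (A i ≈ 0#) × (B i ≈ 0#))
      ab-nonzero (u , v , uv≈2) ab≈0 = two≉0 (begin
        two                              ≈⟨ sym (uv≈2 0) ⟩
        coeff u 0 * A 0 + coeff v 0 * B 0 ≈⟨ +-cong (trans (*-congˡ (proj₁ (ab≈0 0))) (zeroʳ _))
                                                    (trans (*-congˡ (proj₂ (ab≈0 0))) (zeroʳ _)) ⟩
        0# + 0#                          ≈⟨ +-identityʳ 0# ⟩
        0#                               ∎)

      -- [a,b] ∉ 2R[z]², since its leading coefficient is a unit.
      ab-odd : InIdeal two a b → ¬ In2Poly a b
      ab-odd id2 (a₀ , b₀ , a≈2a₀ , b≈2b₀) =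
        unit∉2R (lead-unit τ lt)
          (component-preserves In2R τ (λ i → coeff a₀ i , a≈2a₀ i) (λ i → coeff b₀ i , b≈2b₀ i) (idx τ))
        where
        τ = proj₁ (lt-exist a b (ab-nonzero id2))
        lt = proj₂ (lt-exist a b (ab-nonzero id2))

      M∖2M-odd : ∀ c d → M∖2M t T c d → InM t T c d × ¬ Div2.AllIn c d
      M∖2M-odd c d (inMc , odd) = inMc , λ all-even → odd (in2Poly c d all-even)

      M∖2M-nonzero : ∀ c d → M∖2M t T c d → InM t T c d × ¬ Div0.AllIn c d
      M∖2M-nonzero c d (inMc , odd) = inMc , λ all≈0 →
        odd (in2Poly c d (λ i → Mod2.In-≈0 (proj₁ (all≈0 i)) , Mod2.In-≈0 (proj₂ (all≈0 i))))

      part-a-minimal : InIdeal two a b → Minimal (M∖2M t T) a b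
      part-a-minimal id2 = Div2.minimal (M∖2M t T) M∖2M-odd (quotients-mod2 id2) (inM , ab-odd id2)

      part-a-unique : InIdeal two a b → ∀ c d → Minimal (M∖2M t T) c d →
        ∃ λ (ν : Carrier) → IsKUnit ν × (∀ i → A i ≈K (ν *R coeff c i)) × (∀ i → B i ≈K (ν *R coeff d i))
      part-a-unique id2 c d min = invert (Div2.unique (M∖2M t T) M∖2M-odd (quotients-mod2 id2) (inM , ab-odd id2) c d min)
        where
        -- the constant w₀ ∉ 2R is a unit, with inverse ν
        invert : Div2.ConstantMultiple c d →
          ∃ λ (ν : Carrier) → IsKUnit ν × (∀ i → A i ≈K (ν *R coeff c i)) × (∀ i → B i ≈K (ν *R coeff d i))
        invert (w₀ , w₀∉2R , c~aw₀ , d~bw₀) =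
          ν , (w₀ , Mod2.~-reflexive νw₀≈1) ,
          (λ i → Mod2.rescale νw₀≈1 (c~aw₀ i)) , (λ i → Mod2.rescale νw₀≈1 (d~bw₀ i))
          where
          ν = proj₁ (¬2R⇒unit w₀∉2R)
          νw₀≈1 : ν * w₀ ≈ 1#
          νw₀≈1 = trans (*-comm ν w₀) (proj₂ (¬2R⇒unit w₀∉2R))

      part-b-minimal : InIdeal two a b → InIdeal 1# a b → Minimal (M∖0 t T) a b
      part-b-minimal id2 id1 = Div0.minimal (M∖0 t T) (λ c d c,d∈ → c,d∈) (quotients-exact id1) (inM , ab-nonzero id2)

      part-b-unique : InIdeal two a b → InIdeal 1# a b → ∀ c d → Minimal (M∖2M t T) c d →
        ∃ λ (θ : Carrier) → IsUnit θ × (∀ i → A i ≈ (θ *R coeff c i)) × (∀ i → B i ≈ (θ *R coeff d i))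
      part-b-unique id2 id1 c d min =
        invert (Div0.unique (M∖2M t T) M∖2M-nonzero (quotients-exact id1) (inM , ab-odd id2) c d min)
        where
        -- w₀ ∉ 2R, as otherwise [c,d] = w₀·[a,b] ∈ 2R[z]²; so w₀ is a unit, with inverse θ
        invert : Div0.ConstantMultiple c d →
          ∃ λ (θ : Carrier) → IsUnit θ × (∀ i → A i ≈ (θ *R coeff c i)) × (∀ i → B i ≈ (θ *R coeff d i))
        invert (w₀ , _ , c≈aw₀ , d≈bw₀) =
          θ , (w₀ , θw₀≈1) , (λ i → x∙y⁻¹≈ε⇒x≈y _ _ (Mod0.rescale θw₀≈1 (c≈aw₀ i)))
                           , (λ i → x∙y⁻¹≈ε⇒x≈y _ _ (Mod0.rescale θw₀≈1 (d≈bw₀ i)))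
          where
          even : ∀ (F : Series) {x i} → In2R w₀ → x Mod0.~ F i * w₀ → In2R x
          even F w₀∈2R e = Mod2.In-resp (sym (x∙y⁻¹≈ε⇒x≈y _ _ e)) (Mod2.In-* _ w₀∈2R)
          w₀∉2R : ¬ In2R w₀
          w₀∉2R w₀∈2R = proj₂ (proj₁ min)
            (in2Poly c d (λ i → even A w₀∈2R (c≈aw₀ i) , even B w₀∈2R (d≈bw₀ i)))
          θ = proj₁ (¬2R⇒unit w₀∉2R)
          θw₀≈1 : θ * w₀ ≈ 1#
          θw₀≈1 = trans (*-comm θ w₀) (proj₂ (¬2R⇒unit w₀∉2R))

open import Data.Nat using (_*_; _+_; _<_; _≤_)

theorem6p5 : ∀ {c ℓ} (R : CommutativeRing c ℓ) → let open Defs.Ring R in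
    (m : ℕ) → IsGR4 m →
    (t : ℕ) → 1 ≤ t → (T : Series) →
    (a b : Poly) → InM t T a b →
    (∀ i → suc t < 2 * i → coeff a i ≈ 0#) →
    (∀ i → t < 2 * i → coeff b i ≈ 0#) →
    InIdeal two a b →
    (∀ n → IsDeg a n → (∀ i → n ≤ i → coeff b i ≈ 0#) → IsUnit (coeff a n)) →
    (∀ k → IsDeg b k → (∀ i → k < i → coeff a i ≈ 0#) → IsUnit (coeff b k)) →
    (Minimal (M∖2M t T) a b ×
    (∀ a' b' → Minimal (M∖2M t T) a' b' →
    ∃ λ (ν : Carrier) → IsKUnit ν ×
    (∀ i → coeff a i ≈K (ν *R coeff a' i)) ×
    (∀ i → coeff b i ≈K (ν *R coeff b' i))))
    ×
    (InIdeal 1# a b →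
    Minimal (M∖0 t T) a b ×
    (∀ a' b' → Minimal (M∖2M t T) a' b' →
    ∃ λ (θ : Carrier) → IsUnit θ ×
    (∀ i → coeff a i ≈ (θ *R coeff a' i)) ×
    (∀ i → coeff b i ≈ (θ *R coeff b' i))))
theorem6p5 R m gr t _ T a b inM deg-a deg-b id2 lc-a lc-b =
    (part-a-minimal id2 , part-a-unique id2)
  , λ id1 → part-b-minimal id2 id1 , part-b-unique id2 id1
  where
  open Proof.GR4.Setting R gr t T a b inM deg-a deg-b lc-a lc-b
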